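{- Let $(X,\sim)$ be a partially ordered set and define $x<y$ iff $x\sim y$ and $\neg(x=y)$. Assume that for all $x,y\in X$, $\neg(y<x)$ implies $x\sim y$. Then: (1) for all $x,y\in X$, $x\leq_{P}y$ implies $x\sim y$; (2) for all $x,y\in X$, $x\leq_{P}y$ and $y\leq_{P}x$ imply $x=y$.
   Context: The setting is constructive mathematics: no use of the law of excluded middle. A partially ordered set is a set $X$ with a binary relation $\sim$ (respecting equality) that is reflexive ($x\sim x$), transitive ($x\sim y$ and $y\sim z$ imply $x\sim z$) and antisymmetric ($x\sim y$ and $y\sim x$ imply $x=y$). For the relation $<$, $x\leq_{P}y$ means that for all $z\in X$, $z<x$ implies $z<y$, and $y<z$ implies $x<z$. -}

module Defs where

open import Level using (Level)
open import Relation.Binary.Core using (Rel)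
open import Relation.Binary.PropositionalEquality using (_≡_)
open import Relation.Nullary using (¬_)
open import Data.Product using (_×_)

Strict : ∀ {a ℓ} {X : Set a} → Rel X ℓ → Rel X _
Strict _∼_ x y = (x ∼ y) × ¬ (x ≡ y)

≤P : ∀ {a ℓ} {X : Set a} → Rel X ℓ → Rel X _
≤P {X = X} _<_ x y = (z : X) → (z < x → z < y) × (y < z → x < z)

module Submission where

open import Defs
open import Relation.Binary.Core using (Rel)
open import Relation.Binary.Definitions using (Irreflexive)
open import Relation.Binary.Structures using (IsPartialOrder)
open import Relation.Binary.PropositionalEquality using (_≡_; refl)
open import Relation.Nullary using (¬_)
open import Data.Product using (_×_; _,_; proj₁)

-- If y < x, then taking z = y in x ≤P y would give y < y.
≤P⇒¬flip : ∀ {a ℓ} {X : Set a} {_<_ : Rel X ℓ} → Irreflexive _≡_ _<_ →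
           ∀ {x y} → ≤P _<_ x y → ¬ (y < x)
≤P⇒¬flip irrefl {y = y} x≤y y<x = irrefl refl (proj₁ (x≤y y) y<x)

Strict-irrefl : ∀ {a ℓ} {X : Set a} (_∼_ : Rel X ℓ) → Irreflexive _≡_ (Strict _∼_)
Strict-irrefl _∼_ x≡y (_ , x≢y) = x≢y x≡y

theorem14 : ∀ {a ℓ} {X : Set a} (_∼_ : Rel X ℓ) →
    IsPartialOrder _≡_ _∼_ →
    (∀ x y → ¬ (Strict _∼_ y x) → x ∼ y) →
    (∀ x y → ≤P (Strict _∼_) x y → x ∼ y)
    × (∀ x y → ≤P (Strict _∼_) x y → ≤P (Strict _∼_) y x → x ≡ y)
theorem14 _∼_ isPartialOrder ¬>⇒∼ = ≤P⇒∼ , ≤P-antisym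
  where
  ≤P⇒∼ : ∀ x y → ≤P (Strict _∼_) x y → x ∼ y
  ≤P⇒∼ x y x≤y = ¬>⇒∼ x y (≤P⇒¬flip (Strict-irrefl _∼_) x≤y)

  ≤P-antisym : ∀ x y → ≤P (Strict _∼_) x y → ≤P (Strict _∼_) y x → x ≡ y
  ≤P-antisym x y x≤y y≤x =
    IsPartialOrder.antisym isPartialOrder (≤P⇒∼ x y x≤y) (≤P⇒∼ y x y≤x)
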